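{- Let $g$ and $Q$ be positive integers with $g<Q$, and let $n\ge1$. If $\tilde D$ is any $g$-colored distribution of $Q(2^n-1)$ pebbles on the vertices of the path $P_n$ on $n$ vertices, then $\tilde D$ is $Q$-coverable.
   Context: A $g$-colored distribution is a placement of pebbles on the vertices of a graph in which each pebble is assigned one of $g$ colors. A color-respecting pebbling step removes two pebbles of the same color from a vertex and places one pebble of that color on an adjacent vertex. A colored distribution is $Q$-coverable if some sequence of color-respecting pebbling steps results in every vertex having at least $Q$ pebbles (of any colors). -}

module Defs where

open import Data.Nat using (ℕ; zero; suc; _+_; _*_; _∸_; _^_; _≤_; _<_)
open import Data.Fin using (Fin; toℕ; _≟_)
open import Data.Product using (Σ; ∃; _×_; _,_)
open import Data.Sum using (_⊎_)
open import Relation.Nullary using (yes; no)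
open import Relation.Binary.PropositionalEquality using (_≡_)
open import Relation.Binary.Construct.Closure.ReflexiveTransitive using (Star)

∑ : (k : ℕ) → (Fin k → ℕ) → ℕ
∑ zero    f = 0
∑ (suc k) f = f Fin.zero + ∑ k (λ i → f (Fin.suc i))

-- A g-colored distribution on a graph with vertex set Fin n:
-- D v c = number of pebbles of color c on vertex v.
ColoredDist : ℕ → ℕ → Set
ColoredDist n g = Fin n → Fin g → ℕ

size : ∀ {n g} → ColoredDist n g → ℕ
size {n} {g} D = ∑ n (λ v → ∑ g (λ c → D v c))

pebblesAt : ∀ {n g} → ColoredDist n g → Fin n → ℕ
pebblesAt {g = g} D v = ∑ g (D v)

PathAdj : ∀ {n} → Fin n → Fin n → Set
PathAdj u v = suc (toℕ u) ≡ toℕ v ⊎ suc (toℕ v) ≡ toℕ u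

ind : ∀ {n g} → Fin n → Fin n → Fin g → Fin g → ℕ → ℕ
ind a b x y k with a ≟ b | x ≟ y
... | yes _ | yes _ = k
... | _     | _     = 0

data Step {n g : ℕ} (Adj : Fin n → Fin n → Set)
          (D D' : ColoredDist n g) : Set where
  step : (u w : Fin n) (c : Fin g) → Adj u w → 2 ≤ D u c →
         (∀ v d → D' v d ≡
            (D v d ∸ ind v u d c 2) + ind v w d c 1) →
         Step Adj D D'

Coverable : ∀ {n g} (Adj : Fin n → Fin n → Set) → ℕ → ColoredDist n g → Set
Coverable {n} {g} Adj Q D =
  Σ (ColoredDist n g) λ D' → Star (Step Adj) D D' × (∀ v → Q ≤ pebblesAt D' v)

-- Strengthen the claim so that it can be proved one vertex at a time: a segment of m
-- consecutive vertices holding at least Q(2^m - 1) + d 2^m pebbles can be brought to Q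
-- pebbles on every vertex while also sending d pebbles to the vertex just before it. If the
-- first vertex holds a >= Q + 2d pebbles, its surplus is pushed into the rest of the segment
-- until the rest satisfies the claim with d = 0; otherwise the rest delivers the missing
-- Q + 2d - a pebbles to it. Either way the first vertex then holds Q + 2d and pays out d.
-- Colours only constrain feasibility: a vertex with more than g pebbles has two of one
-- colour, and every push above comes from a vertex that keeps at least Q > g pebbles.

module Submission where

open import Defs
open import Data.Nat using (ℕ; zero; suc; _+_; _*_; _∸_; _^_; _≤_; _<_; z≤n; s≤s; _≤?_; >-nonZero)
open import Data.Nat.Properties hiding (_≟_; <⇒≢)
open import Data.Fin using (Fin; zero; suc; toℕ; _≟_)
open import Data.Fin.Properties using (<⇒≢; toℕ-injective) renaming (suc-injective to Fin-suc-injective)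
open import Data.Product using (∃; _×_; _,_)
open import Data.Sum using (_⊎_; inj₁; inj₂)
open import Algebra.Properties.CommutativeSemigroup +-commutativeSemigroup using (xy∙z≈xz∙y)
open import Data.List using (_∷_; [])
open import Function using (_∘_)
open import Relation.Nullary using (yes; no; contradiction)
open import Relation.Binary.PropositionalEquality
open import Relation.Binary.Construct.Closure.ReflexiveTransitive using (Star; ε; _◅_; _◅◅_)
open import Data.Nat.Tactic.RingSolver using (solve)

∑-cong : ∀ k {f h : Fin k → ℕ} → (∀ i → f i ≡ h i) → ∑ k f ≡ ∑ k h
∑-cong zero    _   = refl
∑-cong (suc k) f≡h = cong₂ _+_ (f≡h zero) (∑-cong k (f≡h ∘ suc))

∑-mono : ∀ k {f h : Fin k → ℕ} → (∀ i → f i ≤ h i) → ∑ k f ≤ ∑ k h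
∑-mono zero    _   = z≤n
∑-mono (suc k) f≤h = +-mono-≤ (f≤h zero) (∑-mono k (f≤h ∘ suc))

∑-update : ∀ k {f h : Fin k → ℕ} {m} (c : Fin k) →
  (∀ i → i ≢ c → f i ≡ h i) → f c + m ≡ h c → ∑ k f + m ≡ ∑ k h
∑-update (suc k) {f} {h} {m} zero f≡h fc+m≡hc = begin
  f zero + ∑ k (f ∘ suc) + m    ≡⟨ xy∙z≈xz∙y (f zero) _ m ⟩
  f zero + m + ∑ k (f ∘ suc)    ≡⟨ cong₂ _+_ fc+m≡hc (∑-cong k (λ i → f≡h (suc i) λ ())) ⟩
  h zero + ∑ k (h ∘ suc)        ∎
  where open ≡-Reasoning
∑-update (suc k) {f} {h} {m} (suc c) f≡h fc+m≡hc = begin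
  f zero + ∑ k (f ∘ suc) + m    ≡⟨ +-assoc (f zero) _ m ⟩
  f zero + (∑ k (f ∘ suc) + m)  ≡⟨ cong₂ _+_ (f≡h zero λ ()) (∑-update k c f≡h′ fc+m≡hc) ⟩
  h zero + ∑ k (h ∘ suc)        ∎
  where
  open ≡-Reasoning
  f≡h′ : ∀ i → i ≢ c → f (suc i) ≡ h (suc i)
  f≡h′ i i≢c = f≡h (suc i) (i≢c ∘ Fin-suc-injective)

pigeonhole-≥2 : ∀ g (f : Fin g → ℕ) → g < ∑ g f → ∃ λ c → 2 ≤ f c
pigeonhole-≥2 (suc g) f g<∑ with 2 ≤? f zero
... | yes 2≤f0 = zero , 2≤f0
... | no  2≰f0 with pigeonhole-≥2 g (f ∘ suc) g<∑′
  where
  g<∑′ : g < ∑ g (f ∘ suc)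
  g<∑′ = +-cancelˡ-≤ 1 _ _ (≤-trans g<∑ (+-monoˡ-≤ _ (≤-pred (≰⇒> 2≰f0))))
...   | c , 2≤fc = suc c , 2≤fc

module _ {n g : ℕ} {a b : Fin n} {x y : Fin g} {k : ℕ} where

  ind-≢ᵛ : a ≢ b → ind a b x y k ≡ 0
  ind-≢ᵛ a≢b with a ≟ b | x ≟ y
  ... | yes a≡b | _ = contradiction a≡b a≢b
  ... | no _    | _ = refl

  ind-≢ᶜ : x ≢ y → ind a b x y k ≡ 0
  ind-≢ᶜ x≢y with a ≟ b | x ≟ y
  ... | yes _ | yes x≡y = contradiction x≡y x≢y
  ... | yes _ | no _    = refl
  ... | no _  | _       = refl

ind-refl : ∀ {n g} {a : Fin n} {x : Fin g} {k} → ind a a x x k ≡ k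
ind-refl {a = a} {x} with a ≟ a | x ≟ x
... | yes _ | yes _  = refl
... | yes _ | no x≢x = contradiction refl x≢x
... | no a≢a | _     = contradiction refl a≢a

module _ {n g : ℕ} where

  move : ColoredDist n g → Fin n → Fin n → Fin g → ColoredDist n g
  move D u w c v d = (D v d ∸ ind v u d c 2) + ind v w d c 1

  module _ (D : ColoredDist n g) (c : Fin g) {u w : Fin n} where

    move-≢ᶜ : ∀ {v d} → d ≢ c → move D u w c v d ≡ D v d
    move-≢ᶜ {v} {d} d≢c = begin
      (D v d ∸ ind v u d c 2) + ind v w d c 1  ≡⟨ cong₂ (λ r t → (D v d ∸ r) + t) (ind-≢ᶜ {a = v} {u} {k = 2} d≢c) (ind-≢ᶜ {a = v} {w} {k = 1} d≢c) ⟩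
      D v d + 0                                ≡⟨ +-identityʳ (D v d) ⟩
      D v d                                    ∎
      where open ≡-Reasoning

    move-source : u ≢ w → 2 ≤ D u c → pebblesAt (move D u w c) u + 2 ≡ pebblesAt D u
    move-source u≢w 2≤Duc = ∑-update g c (λ _ → move-≢ᶜ) (begin
      (D u c ∸ ind u u c c 2) + ind u w c c 1 + 2  ≡⟨ cong₂ (λ r t → (D u c ∸ r) + t + 2) (ind-refl {a = u} {c} {2}) (ind-≢ᵛ {x = c} {c} {1} u≢w) ⟩
      (D u c ∸ 2) + 0 + 2                          ≡⟨ cong (_+ 2) (+-identityʳ _) ⟩
      (D u c ∸ 2) + 2                              ≡⟨ m∸n+n≡m 2≤Duc ⟩
      D u c                                        ∎)
      where open ≡-Reasoning

    move-target : u ≢ w → pebblesAt D w + 1 ≡ pebblesAt (move D u w c) w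
    move-target u≢w = ∑-update g c (λ _ d≢c → sym (move-≢ᶜ d≢c)) (sym (begin
      (D w c ∸ ind w u c c 2) + ind w w c c 1  ≡⟨ cong₂ (λ r t → (D w c ∸ r) + t) (ind-≢ᵛ {x = c} {c} {2} (≢-sym u≢w)) (ind-refl {a = w} {c} {1}) ⟩
      D w c + 1                                ∎))
      where open ≡-Reasoning

    move-others : ∀ {v} → v ≢ u → pebblesAt D v ≤ pebblesAt (move D u w c) v
    move-others {v} v≢u = ∑-mono g λ d → subst (λ r → D v d ≤ (D v d ∸ r) + ind v w d c 1)
      (sym (ind-≢ᵛ {x = d} {c} {2} v≢u)) (m≤m+n (D v d) _)

module _ {n g : ℕ} {Adj : Fin n → Fin n → Set} (loopless : ∀ {u w} → Adj u w → u ≢ w) where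

  record Pushed (D : ColoredDist n g) (u w : Fin n) (k : ℕ) : Set where
    field
      after  : ColoredDist n g
      reach  : Star (Step Adj) D after
      source : pebblesAt after u + (k + k) ≡ pebblesAt D u
      target : pebblesAt D w + k ≡ pebblesAt after w
      others : ∀ v → v ≢ u → pebblesAt D v ≤ pebblesAt after v

  push : ∀ {D u w} → Adj u w → ∀ k → g + (k + k) < pebblesAt D u → Pushed D u w k
  push {D} _ zero _ = record
    { after = D ; reach = ε ; source = +-identityʳ _ ; target = +-identityʳ _ ; others = λ _ _ → ≤-refl }
  push {D} {u} {w} adj (suc k) feasible with pigeonhole-≥2 g (D u) (≤-trans (s≤s (m≤m+n g _)) feasible)
  ... | c , 2≤Duc = record
    { after  = P.after
    ; reach  = step u w c adj 2≤Duc (λ _ _ → refl) ◅ P.reach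
    ; source = trans (shift (pebblesAt P.after u)) (trans (cong (_+ 2) P.source) (move-source D c u≢w 2≤Duc))
    ; target = trans (sym (+-assoc (pebblesAt D w) 1 k)) (trans (cong (_+ k) (move-target D c u≢w)) P.target)
    ; others = λ v v≢u → ≤-trans (move-others D c v≢u) (P.others v v≢u)
    }
    where
    u≢w : u ≢ w
    u≢w = loopless adj
    D₁ : ColoredDist n g
    D₁ = move D u w c
    shift : ∀ x → x + (suc k + suc k) ≡ x + (k + k) + 2
    shift x = solve (x ∷ k ∷ [])
    feasible₁ : g + (k + k) < pebblesAt D₁ u
    feasible₁ = +-cancelʳ-≤ 2 _ _
      (subst₂ _≤_ (shift (suc g)) (sym (move-source D c u≢w 2≤Duc)) feasible)
    module P = Pushed (push {D₁} adj k feasible₁)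

pull-budget : ∀ {Q d a d′ R T} → 1 ≤ T → a + d′ ≡ Q + (d + d) →
  (Q + d) * (2 * T) ≤ a + R + Q → (Q + d′) * T ≤ R + Q
pull-budget {Q} {d} {a} {d′} {R} {T} 1≤T a+d′≡ H = +-cancelʳ-≤ (a * T) _ _ (begin
  (Q + d′) * T + a * T     ≡⟨ solve (Q ∷ d′ ∷ a ∷ T ∷ []) ⟩
  (Q + (a + d′)) * T       ≡⟨ cong (λ z → (Q + z) * T) a+d′≡ ⟩
  (Q + (Q + (d + d))) * T  ≡⟨ solve (Q ∷ d ∷ T ∷ []) ⟩
  (Q + d) * (2 * T)        ≤⟨ H ⟩
  a + R + Q                ≤⟨ +-monoˡ-≤ Q (+-monoˡ-≤ R (m≤m*n a T {{>-nonZero 1≤T}})) ⟩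
  a * T + R + Q            ≡⟨ solve (a ∷ T ∷ R ∷ Q ∷ []) ⟩
  R + Q + a * T            ∎)
  where open ≤-Reasoning

-- k is the shortfall Q T - (R + Q) of the rest of the segment, or 0 if there is none.
push-budget : ∀ {Q d a R T} → 1 ≤ T → (Q + d) * (2 * T) ≤ a + R + Q → Q + (d + d) ≤ a →
  ∃ λ k → Q * T ≤ R + k + Q × Q + (d + d) + (k + k) ≤ a
push-budget {Q} {d} {a} {R} {T} 1≤T H Q+2d≤a with ≤-total (Q * T) (R + Q)
... | inj₁ QT≤R+Q = 0 , subst (Q * T ≤_) (cong (_+ Q) (sym (+-identityʳ R))) QT≤R+Q ,
                    subst (_≤ a) (sym (+-identityʳ _)) Q+2d≤a
... | inj₂ R+Q≤QT with m≤n⇒∃[o]m+o≡n R+Q≤QT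
...   | k , R+Q+k≡QT = k , ≤-reflexive (trans (sym R+Q+k≡QT) (solve (R ∷ Q ∷ k ∷ []))) ,
  +-cancelʳ-≤ (R + R + Q) _ _ (begin
    Q + (d + d) + (k + k) + (R + R + Q)  ≡⟨ solve (Q ∷ d ∷ k ∷ R ∷ []) ⟩
    (R + Q + k) * 2 + d * 2              ≡⟨ cong (λ z → z * 2 + d * 2) R+Q+k≡QT ⟩
    Q * T * 2 + d * 2                    ≤⟨ +-monoʳ-≤ (Q * T * 2) (*-monoˡ-≤ 2 (m≤m*n d T {{>-nonZero 1≤T}})) ⟩
    Q * T * 2 + d * T * 2                ≡⟨ solve (Q ∷ T ∷ d ∷ []) ⟩
    (Q + d) * (2 * T)                    ≤⟨ H ⟩
    a + R + Q                            ≤⟨ m≤m+n (a + R + Q) R ⟩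
    a + R + Q + R                        ≡⟨ solve (a ∷ R ∷ Q ∷ []) ⟩
    a + (R + R + Q)                      ∎)
  where open ≤-Reasoning

*-pred-+ : ∀ Q T → 1 ≤ T → Q * (T ∸ 1) + Q ≡ Q * T
*-pred-+ Q (suc t) _ = trans (+-comm (Q * t) Q) (sym (*-suc Q t))

PathAdj-irrefl : ∀ {n} {u w : Fin n} → PathAdj u w → u ≢ w
PathAdj-irrefl (inj₁ e) refl = 1+n≢n e
PathAdj-irrefl (inj₂ e) refl = 1+n≢n e

<-position⇒≢ : ∀ {n s} {v u : Fin n} → toℕ v < s → toℕ u ≡ s → v ≢ u
<-position⇒≢ v<s u≡s = <⇒≢ (subst (_ <_) (sym u≡s) v<s)

Consecutive : ∀ {n m} → ℕ → (Fin m → Fin n) → Set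
Consecutive s seg = ∀ i → toℕ (seg i) ≡ s + toℕ i

module _ {n m s} {seg : Fin (suc m) → Fin n} (consecutive : Consecutive s seg) where

  head-position : toℕ (seg zero) ≡ s
  head-position = trans (consecutive zero) (+-identityʳ s)

  tail-consecutive : Consecutive (suc s) (seg ∘ suc)
  tail-consecutive i = trans (consecutive (suc i)) (+-suc s (toℕ i))

  tail≢head : ∀ i → seg (suc i) ≢ seg zero
  tail≢head i = ≢-sym (<-position⇒≢ head<tail (tail-consecutive i))
    where
    head<tail : toℕ (seg zero) < suc s + toℕ i
    head<tail = subst (_< suc s + toℕ i) (sym head-position) (s≤s (m≤m+n s (toℕ i)))

head-adjacent : ∀ {n m s} {seg : Fin (suc (suc m)) → Fin n} →
  Consecutive s seg → PathAdj (seg zero) (seg (suc zero))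
head-adjacent c = inj₁ (trans (cong suc (head-position c)) (sym (head-position (tail-consecutive c))))

-- The vertex s - 1 receiving the d pebbles; it may be missing only if d = 0.
Outlet : ∀ n → ℕ → ℕ → Set
Outlet n s d = d ≡ 0 ⊎ ∃ λ (x : Fin n) → suc (toℕ x) ≡ s

module _ {n g : ℕ} (Q : ℕ) where

  record Delivery (D : ColoredDist n g) (s d : ℕ) {m} (seg : Fin m → Fin n) : Set where
    field
      after    : ColoredDist n g
      reach    : Star (Step PathAdj) D after
      covers   : ∀ i → Q ≤ pebblesAt after (seg i)
      keeps    : ∀ v → toℕ v < s → pebblesAt D v ≤ pebblesAt after v
      delivers : ∀ x → suc (toℕ x) ≡ s → pebblesAt D x + d ≤ pebblesAt after x

  record Prepared (D : ColoredDist n g) (s d : ℕ) {m} (seg : Fin (suc m) → Fin n) : Set where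
    field
      after       : ColoredDist n g
      reach       : Star (Step PathAdj) D after
      head-stock  : Q + (d + d) ≤ pebblesAt after (seg zero)
      covers-tail : ∀ i → Q ≤ pebblesAt after (seg (suc i))
      keeps       : ∀ v → toℕ v < s → pebblesAt D v ≤ pebblesAt after v

  -- The budget (Q + d) 2^m ≤ pebbles + Q says the segment holds Q(2^m - 1) + d 2^m pebbles.
  Coverer : ℕ → Set
  Coverer m = ∀ {s d} {seg : Fin m → Fin n} {D : ColoredDist n g} →
    Consecutive s seg → Outlet n s d → (Q + d) * 2 ^ m ≤ ∑ m (pebblesAt D ∘ seg) + Q →
    Delivery D s d seg

module _ {n g Q : ℕ} (g<Q : g < Q) where

  deliver : ∀ {m s d} {seg : Fin (suc m) → Fin n} {D : ColoredDist n g} →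
    Consecutive s seg → Outlet n s d → Prepared Q D s d seg → Delivery Q D s d seg
  deliver {seg = seg} c (inj₁ refl) P = record
    { after = P.after ; reach = P.reach ; covers = covers ; keeps = P.keeps
    ; delivers = λ x x→s → subst (_≤ _) (sym (+-identityʳ _)) (P.keeps x (≤-reflexive x→s))
    }
    where
    module P = Prepared P
    covers : ∀ i → Q ≤ pebblesAt P.after (seg i)
    covers zero    = ≤-trans (m≤m+n Q 0) P.head-stock
    covers (suc i) = P.covers-tail i
  deliver {s = s} {d} {seg} {D} c (inj₂ (x , x→s)) P = record
    { after = O.after ; reach = P.reach ◅◅ O.reach ; covers = covers
    ; keeps = λ v v<s → ≤-trans (P.keeps v v<s) (O.others v (<-position⇒≢ v<s (head-position c)))
    ; delivers = delivers
    }
    where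
    module P = Prepared P
    module O = Pushed (push PathAdj-irrefl {P.after} (inj₂ (trans x→s (sym (head-position c)))) d
                 (≤-trans (+-monoˡ-≤ (d + d) g<Q) P.head-stock))
    covers : ∀ i → Q ≤ pebblesAt O.after (seg i)
    covers zero    = +-cancelʳ-≤ (d + d) Q _ (subst (Q + (d + d) ≤_) (sym O.source) P.head-stock)
    covers (suc i) = ≤-trans (P.covers-tail i) (O.others _ (tail≢head c i))
    delivers : ∀ x′ → suc (toℕ x′) ≡ s → pebblesAt D x′ + d ≤ pebblesAt O.after x′
    delivers x′ x′→s with toℕ-injective (suc-injective (trans x′→s (sym x→s)))
    ... | refl = ≤-trans (+-monoˡ-≤ d (P.keeps x (≤-reflexive x→s))) (≤-reflexive O.target)

  prepare-by-pulling : ∀ {m s d} {seg : Fin (suc m) → Fin n} {D : ColoredDist n g} → Coverer {n} {g} Q m →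
    Consecutive s seg → pebblesAt D (seg zero) ≤ Q + (d + d) →
    (Q + d) * 2 ^ suc m ≤ ∑ (suc m) (pebblesAt D ∘ seg) + Q → Prepared Q D s d seg
  prepare-by-pulling {m} {d = d} {seg} {D} cover c a≤Q+2d H = record
    { after = R.after ; reach = R.reach
    ; head-stock = subst (_≤ pebblesAt R.after (seg zero)) (m+[n∸m]≡n a≤Q+2d)
                         (R.delivers (seg zero) (cong suc (head-position c)))
    ; covers-tail = R.covers
    ; keeps = λ v v<s → R.keeps v (m<n⇒m<1+n v<s)
    }
    where
    module R = Delivery (cover {D = D} (tail-consecutive c) (inj₂ (seg zero , cong suc (head-position c)))
                 (pull-budget {Q} {d} (m^n>0 2 m) (m+[n∸m]≡n a≤Q+2d) H))

  prepare-by-pushing : ∀ {m s d} {seg : Fin (suc m) → Fin n} {D : ColoredDist n g} → Coverer {n} {g} Q m →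
    Consecutive s seg → Q + (d + d) ≤ pebblesAt D (seg zero) →
    (Q + d) * 2 ^ suc m ≤ ∑ (suc m) (pebblesAt D ∘ seg) + Q → Prepared Q D s d seg
  prepare-by-pushing {zero} {D = D} _ _ stock _ = record
    { after = D ; reach = ε ; head-stock = stock ; covers-tail = λ () ; keeps = λ _ _ → ≤-refl }
  prepare-by-pushing {suc m} {s} {d} {seg} {D} cover c stock H
    with push-budget (m^n>0 2 (suc m)) H stock
  ... | k , QT≤R+k+Q , stock+2k = record
    { after = R.after
    ; reach = P.reach ◅◅ R.reach
    ; head-stock = ≤-trans (+-cancelʳ-≤ (k + k) _ _ (subst (_ ≤_) (sym P.source) stock+2k))
                           (R.keeps (seg zero) (s≤s (≤-reflexive (head-position c))))
    ; covers-tail = R.covers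
    ; keeps = λ v v<s → ≤-trans (P.others v (<-position⇒≢ v<s (head-position c))) (R.keeps v (m<n⇒m<1+n v<s))
    }
    where
    module P = Pushed (push PathAdj-irrefl {D} (head-adjacent c) k
                 (≤-trans (+-monoˡ-≤ (k + k) (≤-trans g<Q (m≤m+n Q (d + d)))) stock+2k))
    tail-gain : ∑ (suc m) (pebblesAt D ∘ seg ∘ suc) + k ≤ ∑ (suc m) (pebblesAt P.after ∘ seg ∘ suc)
    tail-gain = begin
      pebblesAt D (seg (suc zero)) + ∑ m (λ i → pebblesAt D (seg (suc (suc i)))) + k
        ≡⟨ xy∙z≈xz∙y (pebblesAt D (seg (suc zero))) _ k ⟩
      pebblesAt D (seg (suc zero)) + k + ∑ m (λ i → pebblesAt D (seg (suc (suc i))))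
        ≤⟨ +-mono-≤ (≤-reflexive P.target) (∑-mono m (λ i → P.others _ (tail≢head c (suc i)))) ⟩
      pebblesAt P.after (seg (suc zero)) + ∑ m (λ i → pebblesAt P.after (seg (suc (suc i)))) ∎
      where open ≤-Reasoning
    tail-budget : (Q + 0) * 2 ^ suc m ≤ ∑ (suc m) (pebblesAt P.after ∘ seg ∘ suc) + Q
    tail-budget = begin
      (Q + 0) * 2 ^ suc m  ≡⟨ cong (_* 2 ^ suc m) (+-identityʳ Q) ⟩
      Q * 2 ^ suc m        ≤⟨ QT≤R+k+Q ⟩
      _ + k + Q            ≤⟨ +-monoˡ-≤ Q tail-gain ⟩
      ∑ (suc m) (pebblesAt P.after ∘ seg ∘ suc) + Q ∎
      where open ≤-Reasoning
    module R = Delivery (cover {D = P.after} (tail-consecutive c) (inj₁ refl) tail-budget)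

  cover-segment : ∀ m → Coverer {n} {g} Q m
  cover-segment zero {d = d} {D = D} _ _ H = record
    { after = D ; reach = ε ; covers = λ () ; keeps = λ _ _ → ≤-refl
    ; delivers = λ x _ → ≤-reflexive (trans (cong (pebblesAt D x +_) d≡0) (+-identityʳ _))
    }
    where
    d≡0 : d ≡ 0
    d≡0 = n≤0⇒n≡0 (+-cancelˡ-≤ Q d 0 (subst₂ _≤_ (*-identityʳ (Q + d)) (sym (+-identityʳ Q)) H))
  cover-segment (suc m) {d = d} {seg} {D} c outlet H with ≤-total (Q + (d + d)) (pebblesAt D (seg zero))
  ... | inj₁ stock  = deliver c outlet (prepare-by-pushing (cover-segment m) c stock H)
  ... | inj₂ a≤Q+2d = deliver c outlet (prepare-by-pulling (cover-segment m) c a≤Q+2d H)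

theorem2p4 : (g Q n : ℕ) → 1 ≤ g → g < Q → 1 ≤ n →
    (D : ColoredDist n g) → size D ≡ Q * (2 ^ n ∸ 1) →
    Coverable PathAdj Q D
theorem2p4 g Q n _ g<Q _ D size≡ = R.after , R.reach , R.covers
  where
  budget : (Q + 0) * 2 ^ n ≤ ∑ n (pebblesAt D) + Q
  budget = ≤-reflexive (begin
    (Q + 0) * 2 ^ n        ≡⟨ cong (_* 2 ^ n) (+-identityʳ Q) ⟩
    Q * 2 ^ n              ≡⟨ sym (*-pred-+ Q (2 ^ n) (m^n>0 2 n)) ⟩
    Q * (2 ^ n ∸ 1) + Q    ≡⟨ cong (_+ Q) (sym size≡) ⟩
    size D + Q             ∎)
    where open ≡-Reasoning
  module R = Delivery (cover-segment g<Q n {seg = λ v → v} (λ _ → refl) (inj₁ refl) budget)
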